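{- Let $G$ be a finite, connected, reflexive graph and let $k\ge 1$ be an integer. Then $c_0(G)\le k$ if and only if $\lim_{m\to\infty}\operatorname{capt}_k(G,m)$ exists (as a finite number). Furthermore, if both the $0$-visibility capture time of $G$ (with $k$ cops) and the limit $\lim_{m\to\infty}\operatorname{capt}_k(G,m)$ exist, then they are equal.
   Context: All graphs are finite, simple apart from loops, connected and reflexive (every vertex has a loop, so "moving to an adjacent vertex" includes staying put). The game of $k$ cops and $m$ robbers on $G$: in round $0$ the cops choose starting vertices, then the robbers choose starting vertices (several players may share a vertex). In each round $i\ge 1$, every cop moves to an adjacent vertex or stays, and afterwards every robber moves to an adjacent vertex or stays. Whenever a cop occupies the same vertex as some robbers, those robbers are captured and leave the game. All players see everything. The cops win if all robbers are captured after finitely many rounds. $G$ is $k$-cop-win if $k$ cops have a winning strategy against one robber (equivalently against any finite number of robbers). For a $k$-cop-win graph $G$, $\operatorname{capt}_k(G,m)$ is the smallest $t$ such that the $k$ cops have a strategy guaranteeing that, whatever the $m$ robbers do, the last robber is captured by round $t$. The limit $\lim_{m\to\infty}\operatorname{capt}_k(G,m)$ is said to exist only if $G$ is $k$-cop-win and the (nondecreasing) sequence $(\operatorname{capt}_k(G,m))_{m\ge1}$ converges to a finite value. In the $0$-visibility game, $k$ cops play against one robber with the same movement rules, but the cops never see the robber (until he is captured, which ends the game), while the robber sees everything and knows the cops' whole strategy in advance. $c_0(G)$, the $0$-visibility cop number, is the minimum number of cops that can guarantee capture in the $0$-visibility game. The $0$-visibility capture time of $G$ (with $k$ cops) is the maximum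 index of the round in which the robber is captured when the $k$ cops play optimally (i.e. the least $\ell$ such that $k$ cops have a strategy in the $0$-visibility game guaranteeing capture by round $\ell$). -}

module Defs where

open import Data.Nat using (ℕ; zero; suc; _≤_; _<_)
open import Data.Fin using (Fin; _≟_)
open import Data.Fin.Properties using (any?)
open import Data.Bool using (Bool; T)
open import Data.Maybe using (Maybe; just; nothing)
open import Data.Product using (Σ; _×_; _,_)
open import Data.Sum using (_⊎_)
open import Relation.Nullary using (¬_; yes; no)
open import Relation.Binary.PropositionalEquality using (_≡_)
open import Function.Bundles using (_⇔_)

data Reach {n : ℕ} (adj : Fin n → Fin n → Bool) : Fin n → Fin n → Set where
  here  : ∀ {u} → Reach adj u u
  there : ∀ {u w v} → T (adj u w) → Reach adj w v → Reach adj u v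

record Graph : Set where
  field
    n         : ℕ
    adj       : Fin n → Fin n → Bool
    adj-refl  : ∀ v → T (adj v v)
    adj-sym   : ∀ u v → T (adj u v) → T (adj v u)
    nonempty  : 1 ≤ n
    connected : ∀ u v → Reach adj u v

module _ (G : Graph) where
  open Graph G

  V : Set
  V = Fin n

  Adj : V → V → Set
  Adj u v = T (adj u v)

  Cops : ℕ → Set
  Cops k = Fin k → V

  -- state of m robbers: nothing = captured, just v = free at v
  Robbers : ℕ → Set
  Robbers m = Fin m → Maybe V

  OnCop : ∀ {k} → Cops k → V → Set
  OnCop {k} c v = Σ (Fin k) λ i → c i ≡ v

  CopMove : ∀ {k} → Cops k → Cops k → Set
  CopMove c c' = ∀ i → Adj (c i) (c' i)

  data RMove : Maybe V → Maybe V → Set where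
    stay-captured : RMove nothing nothing
    move          : ∀ {u v} → Adj u v → RMove (just u) (just v)

  RobMove : ∀ {m} → Robbers m → Robbers m → Set
  RobMove r r' = ∀ j → RMove (r j) (r' j)

  captureOne : ∀ {k} → Cops k → Maybe V → Maybe V
  captureOne c nothing = nothing
  captureOne c (just v) with any? (λ i → c i ≟ v)
  ... | yes _ = nothing
  ... | no  _ = just v

  capture : ∀ {k m} → Cops k → Robbers m → Robbers m
  capture c r j = captureOne c (r j)

  AllCaptured : ∀ {m} → Robbers m → Set
  AllCaptured r = ∀ j → r j ≡ nothing

  -- WinWithin t c r : from the situation at the end of some round
  -- (cops at c, robbers r), the cops can force that all robbers are
  -- captured within t further rounds.
  WinWithin : ∀ {k m} → ℕ → Cops k → Robbers m → Set
  WinWithin zero    c r = AllCaptured r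
  WinWithin {k} (suc t) c r =
    AllCaptured r ⊎
    Σ (Cops k) λ c' → CopMove c c' ×
      (∀ r' → RobMove (capture c' r) r' → WinWithin t c' (capture c' r'))

  CaptWithin : ℕ → ℕ → ℕ → Set
  CaptWithin k m t =
    Σ (Cops k) λ c₀ → ∀ (r₀ : Fin m → V) → WinWithin t c₀ (capture c₀ (λ j → just (r₀ j)))

  IsCapt : ℕ → ℕ → ℕ → Set
  IsCapt k m t = CaptWithin k m t × (∀ t' → t' < t → ¬ CaptWithin k m t')

  KCopWin : ℕ → Set
  KCopWin k = Σ ℕ λ t → CaptWithin k 1 t

  LimitIs : ℕ → ℕ → Set
  LimitIs k L = KCopWin k × Σ ℕ λ M → ∀ m → 1 ≤ m → M ≤ m → IsCapt k m L

  LimitExists : ℕ → Set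
  LimitExists k = Σ ℕ λ L → LimitIs k L

  -- 0-visibility game (cops never see the robber; the robber knows
  -- the cops' whole strategy, so a cop strategy is a fixed walk).

  CopWalk : ∀ {k} → (ℕ → Cops k) → Set
  CopWalk c = ∀ i → CopMove (c i) (c (suc i))

  RobWalkUpTo : ℕ → (ℕ → V) → Set
  RobWalkUpTo ℓ r = ∀ i → i < ℓ → Adj (r i) (r (suc i))

  -- the robber (position r i at the end of round i) is captured in round i
  CaughtAt : ∀ {k} → (ℕ → Cops k) → (ℕ → V) → ℕ → Set
  CaughtAt c r zero    = OnCop (c zero) (r zero)
  CaughtAt c r (suc i) = OnCop (c (suc i)) (r i) ⊎ OnCop (c (suc i)) (r (suc i))

  ZVWithin : ℕ → ℕ → Set
  ZVWithin k ℓ = Σ (ℕ → Cops k) λ c → CopWalk c ×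
    (∀ r → RobWalkUpTo ℓ r → Σ ℕ λ i → i ≤ ℓ × CaughtAt c r i)

  ZVCanCapture : ℕ → Set
  ZVCanCapture k = Σ ℕ λ ℓ → ZVWithin k ℓ

  C0≤ : ℕ → Set
  C0≤ k = Σ ℕ λ j → j ≤ k × ZVCanCapture j

  ZVCaptTime : ℕ → ℕ → Set
  ZVCaptTime k ℓ = ZVWithin k ℓ × (∀ ℓ' → ℓ' < ℓ → ¬ ZVWithin k ℓ')

{-# OPTIONS --safe #-}
-- A 0-visibility strategy is a fixed cop walk that meets every robber walk by round t; k cops
-- following it catch any number of visible robbers by round t.  Conversely, m ≥ n ^ (t+1) robbers
-- can occupy every vertex sequence of length t+1 (turned into a walk) and follow it blindly.
-- Such robbers never react, so a visible strategy capturing them all by round t unfolds into a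
-- single cop walk, which then meets every robber walk by round t.  Hence, for all m ≥ n ^ (t+1),
-- capt_k(G,m) ≤ t iff the 0-visibility capture time is ≤ t.  The latter is decidable (only
-- finitely many prefixes of walks matter), so the least such t exists and is the limit.
module Submission where

open import Defs
open import Level using (0ℓ)
open import Data.Nat
  using (ℕ; zero; suc; _≤_; _<_; _^_; _*_; _+_; _⊓_; _<?_; z≤n; s≤s; s≤s⁻¹; NonZero; >-nonZero)
open import Data.Nat.Properties
  using (≤-refl; ≤-trans; ≤-antisym; <⇒≤; ≮⇒≥; n≤1+n; m≤n⇒m≤1+n; m≤m+n; m≤n+m; *-identityʳ;
         ^-monoʳ-≤; m≤n⇒m⊓n≡m; m≥n⇒m⊓n≡n; anyUpTo?; allUpTo?)
open import Data.Nat.Induction using (<-rec)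
open import Data.Fin using (Fin; zero; suc; toℕ; fromℕ<; inject≤; combine; remQuot; _≟_)
open import Data.Fin.Properties using (any?; all?; toℕ-inject≤; remQuot-combine)
open import Data.Maybe using (Maybe; just; nothing)
open import Data.Maybe.Relation.Unary.All using (All; just; nothing)
import Data.Maybe as Maybe
open import Data.Product using (Σ; ∃; _×_; _,_; proj₁; proj₂; uncurry)
import Data.Product as Product
open import Data.Product.Relation.Binary.Pointwise.NonDependent
  using () renaming (Pointwise to ×-Pointwise)
open import Data.Sum using (_⊎_; inj₁; inj₂)
open import Data.Empty using (⊥-elim)
open import Data.Vec.Functional using (Vector; _∷_; head; tail)
open import Data.Vec.Functional.Relation.Binary.Pointwise using (Pointwise)
open import Function using (_∘_; _$_; id; const)
open import Function.Bundles using (_⇔_; mk⇔)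
open import Relation.Binary using (Rel)
open import Relation.Binary.PropositionalEquality
  using (_≡_; refl; sym; trans; cong; subst; subst₂; module ≡-Reasoning)
open import Relation.Nullary using (¬_; Dec; yes; no; contradiction)
open import Relation.Nullary.Decidable using (map′; _×-dec_; _⊎-dec_; _→-dec_; T?)
open import Relation.Unary using (Pred; Decidable; _⊆_)

private
  variable
    A B : Set
    _≈_ _∼_ : Rel A 0ℓ

record Enumeration (A : Set) (_≈_ : Rel A 0ℓ) : Set where
  field
    size     : ℕ
    element  : Fin size → A
    complete : ∀ a → Σ (Fin size) λ i → a ≈ element i

open Enumeration

enumFin : ∀ n → Enumeration (Fin n) _≡_
enumFin n = record { size = n ; element = id ; complete = λ a → a , refl }

enum-× : Enumeration A _≈_ → Enumeration B _∼_ → Enumeration (A × B) (×-Pointwise _≈_ _∼_)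
enum-× {_≈_ = _≈_} {_∼_ = _∼_} eA eB = record
  { size     = size eA * size eB
  ; element  = Product.map (element eA) (element eB) ∘ remQuot (size eB)
  ; complete = λ (a , b) →
      let (x , a≈) = complete eA a ; (y , b∼) = complete eB b
      in combine x y
       , subst (×-Pointwise _≈_ _∼_ (a , b) ∘ Product.map (element eA) (element eB))
               (sym (remQuot-combine x y)) (a≈ , b∼)
  }

enum-map : (f : A → B) (g : B → A) → (∀ {b a} → g b ≈ a → b ∼ f a) →
  Enumeration A _≈_ → Enumeration B _∼_
enum-map f g coh e = record
  { size     = size e
  ; element  = f ∘ element e
  ; complete = λ b → let (i , gb≈) = complete e (g b) in i , coh gb≈
  }

enumVector : Enumeration A _≈_ → ∀ k → Enumeration (Vector A k) (Pointwise _≈_)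
enumVector e zero    = enum-map (λ _ ()) (const zero) (λ _ ()) (enumFin 1)
enumVector e (suc k) = enum-map (uncurry _∷_) (λ v → head v , tail v)
  (λ (h≈ , t≈) → λ { zero → h≈ ; (suc i) → t≈ i })
  (enum-× e (enumVector e k))

_∷ₛ_ : A → (ℕ → A) → ℕ → A
(a ∷ₛ f) zero    = a
(a ∷ₛ f) (suc q) = f q

AgreeUpTo : Rel A 0ℓ → ℕ → Rel (ℕ → A) 0ℓ
AgreeUpTo _≈_ t f g = ∀ q → q ≤ t → f q ≈ g q

enumSequence : Enumeration A _≈_ → ∀ t → Enumeration (ℕ → A) (AgreeUpTo _≈_ t)
enumSequence e zero    = enum-map const (_$ 0) (λ f0≈ → λ { zero z≤n → f0≈ }) e
enumSequence e (suc t) = enum-map (uncurry _∷ₛ_) (λ f → f 0 , f ∘ suc)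
  (λ (h≈ , t≈) → λ { zero _ → h≈ ; (suc q) (s≤s q≤t) → t≈ q q≤t })
  (enum-× e (enumSequence e t))

size-enumSequence : (e : Enumeration A _≈_) → ∀ t → size (enumSequence e t) ≡ size e ^ suc t
size-enumSequence e zero    = sym (*-identityʳ (size e))
size-enumSequence e (suc t) = cong (size e *_) (size-enumSequence e t)

module _ (e : Enumeration A _≈_) {P : Pred A 0ℓ} (P? : Decidable P) where

  enum-any? : (∀ {a b} → a ≈ b → P a → P b) → Dec (∃ P)
  enum-any? resp = map′ (λ (i , p) → element e i , p)
    (λ (a , p) → let (i , a≈) = complete e a in i , resp a≈ p)
    (any? (P? ∘ element e))

  enum-all? : (∀ {a b} → a ≈ b → P b → P a) → Dec (∀ a → P a)
  enum-all? resp = map′ (λ h a → let (i , a≈) = complete e a in resp a≈ (h i))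
    (λ h → h ∘ element e)
    (all? (P? ∘ element e))

least : {P : Pred ℕ 0ℓ} → Decidable P → ∀ {n} → P n →
  Σ ℕ λ m → P m × (∀ k → k < m → ¬ P k)
least {P} P? {n} = <-rec Q search n
  where
    Q : Pred ℕ 0ℓ
    Q n = P n → Σ ℕ λ m → P m × (∀ k → k < m → ¬ P k)
    search : ∀ n → (∀ {k} → k < n → Q k) → Q n
    search n below pn with anyUpTo? P? n
    ... | yes (k , k<n , pk) = below k<n pk
    ... | no none            = n , pn , λ k k<n pk → none (k , k<n , pk)

extend : ∀ {a} → A → Vector A a → ℕ → A
extend {a = zero}  d f _       = d
extend {a = suc a} d f zero    = f zero
extend {a = suc a} d f (suc q) = extend d (f ∘ suc) q

extend-toℕ : ∀ {a} (d : A) (f : Vector A a) i → extend d f (toℕ i) ≡ f i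
extend-toℕ d f zero    = refl
extend-toℕ d f (suc i) = extend-toℕ d (f ∘ suc) i

extend-rel : ∀ {a} (R : Rel A 0ℓ) {d} {f g : Vector A a} → R d d → Pointwise R f g →
  ∀ q → R (extend d f q) (extend d g q)
extend-rel {a = zero}  R rd fg _       = rd
extend-rel {a = suc a} R rd fg zero    = fg zero
extend-rel {a = suc a} R rd fg (suc q) = extend-rel R rd (fg ∘ suc) q

positive-upper-bound : ∀ a b → Σ ℕ λ m → 1 ≤ m × a ≤ m × b ≤ m
positive-upper-bound a b =
  suc (a + b) , s≤s z≤n , m≤n⇒m≤1+n (m≤m+n a b) , m≤n⇒m≤1+n (m≤n+m b a)

module _ (G : Graph) where
  open Graph G
  open ≡-Reasoning

  private
    instance
      n-nonZero : NonZero n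
      n-nonZero = >-nonZero nonempty

  v₀ : V G
  v₀ = fromℕ< nonempty

  Walk : (ℕ → V G) → Set
  Walk r = ∀ q → Adj G (r q) (r (suc q))

  CopWalkUpTo : ∀ {k} → ℕ → (ℕ → Cops G k) → Set
  CopWalkUpTo t c = ∀ q → q < t → CopMove G (c q) (c (suc q))

  CaughtBy : ∀ {k} → ℕ → (ℕ → Cops G k) → (ℕ → V G) → Set
  CaughtBy t c r = Σ ℕ λ i → i ≤ t × CaughtAt G c r i

  CapturesBy : ∀ {k} → ℕ → (ℕ → Cops G k) → Set
  CapturesBy t c = ∀ r → RobWalkUpTo G t r → CaughtBy t c r

  CapturesFromBy : ∀ {k} → V G → ℕ → (ℕ → Cops G k) → Set
  CapturesFromBy v d c =
    ∀ r → r 0 ≡ v → RobWalkUpTo G d r → Σ ℕ λ p → p < d × CaughtAt G c r (suc p)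

  robWalkUpTo-cong : ∀ {t r r'} → AgreeUpTo _≡_ t r r' → RobWalkUpTo G t r → RobWalkUpTo G t r'
  robWalkUpTo-cong r≡ walk q q<t =
    subst₂ (Adj G) (r≡ q (<⇒≤ q<t)) (r≡ (suc q) q<t) (walk q q<t)

  onCop-cong : ∀ {k} {c c' : Cops G k} → Pointwise _≡_ c c' → OnCop G c ⊆ OnCop G c'
  onCop-cong c≡ (i , on) = i , trans (sym (c≡ i)) on

  caughtAt-map : ∀ {k k'} {c : ℕ → Cops G k} {c' : ℕ → Cops G k'} {r r'} i →
    (∀ q → q ≤ i → OnCop G (c q) ⊆ OnCop G (c' q)) → AgreeUpTo _≡_ i r r' →
    CaughtAt G c r i → CaughtAt G c' r' i
  caughtAt-map {c = c} zero    cops r≡ on       = cops 0 z≤n (subst (OnCop G (c 0)) (r≡ 0 z≤n) on)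
  caughtAt-map {c = c} (suc i) cops r≡ (inj₁ on) =
    inj₁ (cops (suc i) ≤-refl (subst (OnCop G (c (suc i))) (r≡ i (n≤1+n i)) on))
  caughtAt-map {c = c} (suc i) cops r≡ (inj₂ on) =
    inj₂ (cops (suc i) ≤-refl (subst (OnCop G (c (suc i))) (r≡ (suc i) ≤-refl) on))

  caughtBy-cong : ∀ {k t r r'} {c : ℕ → Cops G k} → AgreeUpTo _≡_ t r r' →
    CaughtBy t c r → CaughtBy t c r'
  caughtBy-cong r≡ (i , i≤t , caught) =
    i , i≤t , caughtAt-map i (λ _ _ → id) (λ q q≤i → r≡ q (≤-trans q≤i i≤t)) caught

  capturesBy-⊆ : ∀ {k k' t} {c : ℕ → Cops G k} {c' : ℕ → Cops G k'} →
    (∀ q → q ≤ t → OnCop G (c q) ⊆ OnCop G (c' q)) → CapturesBy t c → CapturesBy t c'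
  capturesBy-⊆ cops captures r walk =
    let (i , i≤t , caught) = captures r walk
    in i , i≤t , caughtAt-map i (λ q q≤i → cops q (≤-trans q≤i i≤t)) (λ _ _ → refl) caught

  capturesBy-cong : ∀ {k t} {c c' : ℕ → Cops G k} → AgreeUpTo (Pointwise _≡_) t c c' →
    CapturesBy t c → CapturesBy t c'
  capturesBy-cong c≡ = capturesBy-⊆ (λ q q≤t → onCop-cong (c≡ q q≤t))

  captureOne-just : ∀ {k} (c : Cops G k) x {v} → captureOne G c x ≡ just v →
    x ≡ just v × ¬ OnCop G c v
  captureOne-just c nothing ()
  captureOne-just c (just u) eq with any? (λ i → c i ≟ u)
  captureOne-just c (just u) ()   | yes _
  captureOne-just c (just u) refl | no free = refl , free

  captured-or-free : ∀ {k} (c : Cops G k) v → OnCop G c v ⊎ captureOne G c (just v) ≡ just v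
  captured-or-free c v with any? (λ i → c i ≟ v)
  ... | yes on = inj₁ on
  ... | no _   = inj₂ refl

  captureOne-all : ∀ {k} {P : Pred (V G) 0ℓ} (c : Cops G k) {x} →
    All P x → All P (captureOne G c x)
  captureOne-all c {x} px with captureOne G c x in eq
  ... | nothing = nothing
  ... | just v with captureOne-just c x eq
  ...   | refl , _ = px

  survivor-was-free : ∀ {k} (c : Cops G k) x y {v} → RMove G (captureOne G c x) y →
    captureOne G c y ≡ just v →
    Σ (V G) λ u → x ≡ just u × ¬ OnCop G c u × Adj G u v × ¬ OnCop G c v
  survivor-was-free c x y moved eq with captureOne-just c y eq
  ... | refl , v-free with captureOne G c x in eq' | moved
  ...   | just u | move u~v with captureOne-just c x eq'
  ...     | refl , u-free = u , refl , u-free , u~v , v-free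

  prepend-walk : ∀ {d u r} → Adj G u (r 0) → RobWalkUpTo G d r → RobWalkUpTo G (suc d) (u ∷ₛ r)
  prepend-walk u~r₀ walk zero    _           = u~r₀
  prepend-walk u~r₀ walk (suc q) (s≤s q<d) = walk q q<d

  capturesFromBy-step : ∀ {k d u v} {c : ℕ → Cops G k} → CapturesFromBy u (suc d) c →
    ¬ OnCop G (c 1) u → Adj G u v → ¬ OnCop G (c 1) v → CapturesFromBy v d (c ∘ suc)
  capturesFromBy-step {u = u} captures u-free u~v v-free r refl walk
    with captures (u ∷ₛ r) refl (prepend-walk u~v walk)
  ... | zero  , _         , inj₁ on = ⊥-elim (u-free on)
  ... | zero  , _         , inj₂ on = ⊥-elim (v-free on)
  ... | suc p , s≤s p<d , caught  = p , p<d , caught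

  capturesBy⇒capturesFromBy : ∀ {k t v} {c : ℕ → Cops G k} → CapturesBy t c →
    ¬ OnCop G (c 0) v → CapturesFromBy v t c
  capturesBy⇒capturesFromBy captures v-free r refl walk with captures r walk
  ... | zero  , _   , on     = ⊥-elim (v-free on)
  ... | suc p , p<t , caught = p , p<t , caught

  copWalk-wins : ∀ {k m} d (c : ℕ → Cops G k) (R : Robbers G m) → CopWalk G c →
    (∀ j {v} → R j ≡ just v → CapturesFromBy v d c) → WinWithin G d (c 0) R
  copWalk-wins zero c R _ free j with R j in eq
  ... | nothing = refl
  ... | just v with free j eq (const v) refl (λ _ ())
  ...   | _ , () , _
  copWalk-wins (suc d) c R walk free = inj₂ (c 1 , walk 0 , λ R' moved →
    copWalk-wins d (c ∘ suc) (capture G (c 1) R') (walk ∘ suc) λ j eq →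
      let (u , Rj≡u , u-free , u~v , v-free) = survivor-was-free (c 1) (R j) (R' j) (moved j) eq
      in capturesFromBy-step {c = c} (free j Rj≡u) u-free u~v v-free)

  zvWithin⇒captWithin : ∀ {k} m {t} → ZVWithin G k t → CaptWithin G k m t
  zvWithin⇒captWithin m (c , walk , captures) = c 0 , λ r₀ →
    copWalk-wins _ c _ walk λ j eq →
      capturesBy⇒capturesFromBy captures (proj₂ (captureOne-just (c 0) (just (r₀ j)) eq))

  rMove-map-const : ∀ {u v x} → All (_≡ u) x → Adj G u v → RMove G x (Maybe.map (const v) x)
  rMove-map-const nothing     _   = stay-captured
  rMove-map-const (just refl) u~v = move u~v

  all-map-const : ∀ {v : V G} (x : Maybe (V G)) → All (_≡ v) (Maybe.map (const v) x)
  all-map-const nothing  = nothing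
  all-map-const (just _) = just refl

  survives-round : ∀ {k} (c : Cops G k) {x u v} → x ≡ just u →
    captureOne G c (just u) ≡ just u → captureOne G c (just v) ≡ just v →
    captureOne G c (Maybe.map (const v) (captureOne G c x)) ≡ just v
  survives-round c refl u-free v-free rewrite u-free = v-free

  CatchesWalkers : ∀ {k m} → ℕ → Cops G k → Robbers G m → (Fin m → ℕ → V G) → Set
  CatchesWalkers {k} d c R w = Σ (ℕ → Cops G k) λ s → CopWalk G (c ∷ₛ s) ×
    (∀ j → R j ≡ just (w j 0) → Σ ℕ λ p → p < d × CaughtAt G (c ∷ₛ s) (w j) (suc p))

  allCaptured-catchesWalkers : ∀ {k m d c} {R : Robbers G m} {w} → AllCaptured G R →
    CatchesWalkers {k} d c R w
  allCaptured-catchesWalkers {c = c} none =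
    const c , (λ { zero i → adj-refl (c i) ; (suc _) i → adj-refl (c i) }) ,
    λ j Rj≡ → contradiction (trans (sym (none j)) Rj≡) λ ()

  -- The cops' replies along the one play against these non-reacting robbers form the cop walk;
  -- All (_≡ w j 0) (R j) says that robber j is captured or standing at w j 0.
  winWithin⇒catchesWalkers : ∀ {k m} d (c : Cops G k) (R : Robbers G m) (w : Fin m → ℕ → V G) →
    (∀ j → Walk (w j)) → (∀ j → All (_≡ w j 0) (R j)) → WinWithin G d c R → CatchesWalkers d c R w
  winWithin⇒catchesWalkers zero    _ _ _ _ _ none        = allCaptured-catchesWalkers none
  winWithin⇒catchesWalkers (suc d) _ _ _ _ _ (inj₁ none) = allCaptured-catchesWalkers none
  winWithin⇒catchesWalkers {k} {m} (suc d) c R w walks at (inj₂ (c' , c→c' , strategy)) =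
    c' ∷ₛ s , walk , caught
    where
      R' : Robbers G m
      R' j = Maybe.map (const (w j 1)) (captureOne G c' (R j))
      rest : CatchesWalkers d c' (capture G c' R') (λ j → w j ∘ suc)
      rest = winWithin⇒catchesWalkers d c' _ _ (λ j → walks j ∘ suc)
        (λ j → captureOne-all c' (all-map-const (captureOne G c' (R j))))
        (strategy R' λ j → rMove-map-const (captureOne-all c' (at j)) (walks j 0))
      s : ℕ → Cops G k
      s = proj₁ rest
      walk : CopWalk G (c ∷ₛ (c' ∷ₛ s))
      walk zero    = c→c'
      walk (suc q) = proj₁ (proj₂ rest) q
      caught : ∀ j → R j ≡ just (w j 0) →
        Σ ℕ λ p → p < suc d × CaughtAt G (c ∷ₛ (c' ∷ₛ s)) (w j) (suc p)
      caught j Rj≡ with captured-or-free c' (w j 0) | captured-or-free c' (w j 1)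
      ... | inj₁ on    | _          = 0 , s≤s z≤n , inj₁ on
      ... | inj₂ _     | inj₁ on    = 0 , s≤s z≤n , inj₂ on
      ... | inj₂ free₀ | inj₂ free₁ =
        let (p , p<d , caught') = proj₂ (proj₂ rest) j (survives-round c' Rj≡ free₀ free₁)
        in suc p , s≤s p<d , caught'

  captWithin⇒catchesWalks : ∀ {k m t} → CaptWithin G k m t → (w : Fin m → ℕ → V G) →
    (∀ j → Walk (w j)) →
    Σ (ℕ → Cops G k) λ s → CopWalk G s × (∀ j → CaughtBy t s (w j))
  captWithin⇒catchesWalks {k} {t = t} (c₀ , win) w walks = c₀ ∷ₛ s , walk , caught
    where
      start : CatchesWalkers t c₀ _ w
      start = winWithin⇒catchesWalkers t c₀ _ w walks (λ j → captureOne-all c₀ (just refl))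
        (win (λ j → w j 0))
      s : ℕ → Cops G k
      s = proj₁ start
      walk : CopWalk G (c₀ ∷ₛ s)
      walk = proj₁ (proj₂ start)
      caught : ∀ j → CaughtBy t (c₀ ∷ₛ s) (w j)
      caught j with captured-or-free c₀ (w j 0)
      ... | inj₁ on   = 0 , z≤n , on
      ... | inj₂ free =
        let (p , p<t , caught') = proj₂ (proj₂ start) j free in suc p , p<t , caught'

  stepToward : V G → V G → V G
  stepToward u v with T? (adj u v)
  ... | yes _ = v
  ... | no  _ = u

  stepToward-adj : ∀ u v → Adj G u (stepToward u v)
  stepToward-adj u v with T? (adj u v)
  ... | yes u~v = u~v
  ... | no  _   = adj-refl u

  stepToward-≡ : ∀ {u v} → Adj G u v → stepToward u v ≡ v
  stepToward-≡ {u} {v} u~v with T? (adj u v)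
  ... | yes _    = refl
  ... | no ¬u~v = ⊥-elim (¬u~v u~v)

  toWalk : (ℕ → V G) → ℕ → V G
  toWalk g zero    = g 0
  toWalk g (suc q) = stepToward (toWalk g q) (g (suc q))

  toWalk-walk : ∀ g → Walk (toWalk g)
  toWalk-walk g q = stepToward-adj (toWalk g q) (g (suc q))

  toWalk-agrees : ∀ {t g} → RobWalkUpTo G t g → AgreeUpTo _≡_ t (toWalk g) g
  toWalk-agrees         walk zero    _   = refl
  toWalk-agrees {g = g} walk (suc q) q<t = begin
    stepToward (toWalk g q) (g (suc q))
      ≡⟨ cong (λ u → stepToward u (g (suc q))) (toWalk-agrees walk q (<⇒≤ q<t)) ⟩
    stepToward (g q) (g (suc q))
      ≡⟨ stepToward-≡ (walk q q<t) ⟩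
    g (suc q) ∎

  vertexSequences : ∀ t → Enumeration (ℕ → V G) (AgreeUpTo _≡_ t)
  vertexSequences = enumSequence (enumFin n)

  sequenceWalk : ∀ t {m} → Fin m → ℕ → V G
  sequenceWalk t j = toWalk (extend (const v₀) (element (vertexSequences t)) (toℕ j))

  sequenceWalk-covers : ∀ {t m} → n ^ suc t ≤ m → ∀ r → RobWalkUpTo G t r →
    Σ (Fin m) λ j → AgreeUpTo _≡_ t r (sequenceWalk t j)
  sequenceWalk-covers {t} {m} bound r walk with complete (vertexSequences t) r
  ... | i , r≡ = j , agree
    where
      g = element (vertexSequences t) i
      j : Fin m
      j = inject≤ i (subst (_≤ m) (sym (size-enumSequence (enumFin n) t)) bound)
      picks : extend (const v₀) (element (vertexSequences t)) (toℕ j) ≡ g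
      picks = trans (cong (extend (const v₀) (element (vertexSequences t))) (toℕ-inject≤ i _))
                    (extend-toℕ (const v₀) (element (vertexSequences t)) i)
      agree : AgreeUpTo _≡_ t r (sequenceWalk t j)
      agree q q≤t = begin
        r q                ≡⟨ r≡ q q≤t ⟩
        g q                ≡⟨ toWalk-agrees (robWalkUpTo-cong r≡ walk) q q≤t ⟨
        toWalk g q         ≡⟨ cong (λ g′ → toWalk g′ q) picks ⟨
        sequenceWalk t j q ∎

  captWithin⇒zvWithin : ∀ {k m t} → n ^ suc t ≤ m → CaptWithin G k m t → ZVWithin G k t
  captWithin⇒zvWithin {t = t} bound capt
    with captWithin⇒catchesWalks capt (sequenceWalk t) (λ _ → toWalk-walk _)
  ... | s , walk , caught = s , walk , λ r r-walk →
    let (j , r≡) = sequenceWalk-covers bound r r-walk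
    in caughtBy-cong (λ q q≤t → sym (r≡ q q≤t)) (caught j)

  onCop? : ∀ {k} (c : Cops G k) v → Dec (OnCop G c v)
  onCop? c v = any? (λ i → c i ≟ v)

  caughtAt? : ∀ {k} (c : ℕ → Cops G k) r i → Dec (CaughtAt G c r i)
  caughtAt? c r zero    = onCop? (c 0) (r 0)
  caughtAt? c r (suc i) = onCop? (c (suc i)) (r i) ⊎-dec onCop? (c (suc i)) (r (suc i))

  caughtBy? : ∀ {k} t (c : ℕ → Cops G k) r → Dec (CaughtBy t c r)
  caughtBy? t c r = map′ (λ (i , i<1+t , caught) → i , s≤s⁻¹ i<1+t , caught)
    (λ (i , i≤t , caught) → i , s≤s i≤t , caught)
    (anyUpTo? (caughtAt? c r) (suc t))

  robWalkUpTo? : ∀ t r → Dec (RobWalkUpTo G t r)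
  robWalkUpTo? t r = map′ (λ h q → h {q}) (λ h {q} → h q)
    (allUpTo? (λ q → T? (adj (r q) (r (suc q)))) t)

  copWalkUpTo? : ∀ {k} t (c : ℕ → Cops G k) → Dec (CopWalkUpTo t c)
  copWalkUpTo? t c = map′ (λ h q → h {q}) (λ h {q} → h q)
    (allUpTo? (λ q → all? (λ i → T? (adj (c q i) (c (suc q) i)))) t)

  copWalkUpTo-cong : ∀ {k t} {c c' : ℕ → Cops G k} → AgreeUpTo (Pointwise _≡_) t c c' →
    CopWalkUpTo t c → CopWalkUpTo t c'
  copWalkUpTo-cong c≡ walk q q<t i =
    subst₂ (Adj G) (c≡ q (<⇒≤ q<t) i) (c≡ (suc q) q<t i) (walk q q<t i)

  capturesBy? : ∀ {k} t (c : ℕ → Cops G k) → Dec (CapturesBy t c)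
  capturesBy? t c = enum-all? (vertexSequences t) (λ r → robWalkUpTo? t r →-dec caughtBy? t c r)
    λ r≡ escapes walk →
      caughtBy-cong (λ q q≤t → sym (r≡ q q≤t)) (escapes (robWalkUpTo-cong r≡ walk))

  freeze-walk : ∀ {k t} {c : ℕ → Cops G k} → CopWalkUpTo t c → CopWalk G (c ∘ (_⊓ t))
  freeze-walk {t = t} {c} walk q with q <? t
  ... | yes q<t rewrite m≤n⇒m⊓n≡m (<⇒≤ q<t) | m≤n⇒m⊓n≡m q<t = walk q q<t
  ... | no  q≮t rewrite m≥n⇒m⊓n≡n (≮⇒≥ q≮t) | m≥n⇒m⊓n≡n (m≤n⇒m≤1+n (≮⇒≥ q≮t)) =
    adj-refl ∘ c t

  freeze-agrees : ∀ {k t} (c : ℕ → Cops G k) → AgreeUpTo (Pointwise _≡_) t c (c ∘ (_⊓ t))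
  freeze-agrees c q q≤t i = cong (λ q′ → c q′ i) (sym (m≤n⇒m⊓n≡m q≤t))

  -- Only the first t moves of the cop walk matter; afterwards the cops stay put.
  zvWithin? : ∀ k t → Dec (ZVWithin G k t)
  zvWithin? k t = map′
    (λ (c , walk , captures) →
      c ∘ (_⊓ t) , freeze-walk walk , capturesBy-cong (freeze-agrees c) captures)
    (λ (c , walk , captures) → c , (λ q _ → walk q) , captures)
    (enum-any? (enumSequence (enumVector (enumFin n) k) t)
      (λ c → copWalkUpTo? t c ×-dec capturesBy? t c)
      λ c≡ (walk , captures) → copWalkUpTo-cong c≡ walk , capturesBy-cong c≡ captures)

  zvWithin-mono : ∀ {j k t} → j ≤ k → ZVWithin G j t → ZVWithin G k t
  zvWithin-mono {k = k} j≤k (c , walk , captures) =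
    c' , walk' , capturesBy-⊆ (λ q _ → onCop-pad q) captures
    where
      c' : ℕ → Cops G k
      c' q i = extend v₀ (c q) (toℕ i)
      walk' : CopWalk G c'
      walk' q i = extend-rel (Adj G) (adj-refl v₀) (walk q) (toℕ i)
      onCop-pad : ∀ q → OnCop G (c q) ⊆ OnCop G (c' q)
      onCop-pad q (x , on) =
        inject≤ x j≤k ,
        trans (trans (cong (extend v₀ (c q)) (toℕ-inject≤ x j≤k)) (extend-toℕ v₀ (c q) x)) on

  isCapt-unique : ∀ {k m a b} → IsCapt G k m a → IsCapt G k m b → a ≡ b
  isCapt-unique (capt-a , fastest-a) (capt-b , fastest-b) =
    ≤-antisym (≮⇒≥ λ b<a → fastest-a _ b<a capt-b) (≮⇒≥ λ a<b → fastest-b _ a<b capt-a)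

  limitIs-unique : ∀ {k a b} → LimitIs G k a → LimitIs G k b → a ≡ b
  limitIs-unique (_ , M , capt-a) (_ , M' , capt-b) =
    let (m , 1≤m , M≤m , M'≤m) = positive-upper-bound M M'
    in isCapt-unique (capt-a m 1≤m M≤m) (capt-b m 1≤m M'≤m)

  zvCaptTime⇒limitIs : ∀ {k L} → ZVCaptTime G k L → LimitIs G k L
  zvCaptTime⇒limitIs {L = L} (zv , fastest) = (L , zvWithin⇒captWithin 1 zv) , n ^ suc L ,
    λ m _ M≤m → zvWithin⇒captWithin m zv , λ t t<L capt →
      fastest t t<L (captWithin⇒zvWithin (≤-trans (^-monoʳ-≤ n (s≤s (<⇒≤ t<L))) M≤m) capt)

  limitIs⇒zvWithin : ∀ {k L} → LimitIs G k L → ZVWithin G k L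
  limitIs⇒zvWithin {L = L} (_ , M , capt) =
    let (m , 1≤m , M≤m , N≤m) = positive-upper-bound M (n ^ suc L)
    in captWithin⇒zvWithin N≤m (proj₁ (capt m 1≤m M≤m))

  c0≤⇒limitExists : ∀ {k} → C0≤ G k → LimitExists G k
  c0≤⇒limitExists {k} (j , j≤k , _ , zv) =
    let (L , captTime) = least (zvWithin? k) (zvWithin-mono j≤k zv)
    in L , zvCaptTime⇒limitIs captTime

  limitExists⇒c0≤ : ∀ {k} → LimitExists G k → C0≤ G k
  limitExists⇒c0≤ {k} (L , limit) = k , ≤-refl , L , limitIs⇒zvWithin limit

theorem4p11 : (G : Graph) (k : ℕ) → 1 ≤ k →
    (C0≤ G k ⇔ LimitExists G k) ×
    (∀ ℓ L → ZVCaptTime G k ℓ → LimitIs G k L → ℓ ≡ L)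
-- The argument does not use 1 ≤ k.
theorem4p11 G k _ =
  mk⇔ (c0≤⇒limitExists G) (limitExists⇒c0≤ G) ,
  λ _ _ captTime limit → limitIs-unique G (zvCaptTime⇒limitIs G captTime) limit
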